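{- Let $r=r(n)\geq3$ be an integer with $r=o(n^{1/2})$. Let $t$ and $\alpha$ be integers with $t=O(1)$ and $0\leq\alpha\leq rt$. If $H$ is chosen uniformly at random from $\mathcal{H}_r(n,m)$, then the expected number of sets of $t$ edges of $H$ whose union has at most $rt-\alpha$ vertices is $O\bigl(t^\alpha r^{2\alpha}m^tn^{ -\alpha}\bigr)$ as $n\to\infty$.
   Context: $\mathcal{H}_r(n,m)$ is the set of $r$-uniform hypergraphs on vertex set $[n]$ with exactly $m$ edges (edges are $r$-subsets of $[n]$). -}

module Defs where

open import Data.Nat using (ℕ; zero; suc; _+_; _*_; _∸_; _^_; _≤_; _≤?_)
open import Data.Nat.Properties using (_≟_)
open import Data.Bool using (true; false)
open import Data.List using (List; []; _∷_; [_]; map; _++_; filter; length; foldr)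
open import Data.Nat.ListAction using (sum)
open import Data.Vec using (_∷_; [])
open import Data.Fin.Subset using (Subset; ∣_∣; _∪_; ⊥)

allSubsets : (n : ℕ) → List (Subset n)
allSubsets zero = [ [] ]
allSubsets (suc n) = map (true ∷_) (allSubsets n) ++ map (false ∷_) (allSubsets n)

-- all k-element sublists (combinations) of a list; for a duplicate-free
-- list these are exactly the k-element subsets
choose : {A : Set} → List A → ℕ → List (List A)
choose xs zero = [ [] ]
choose [] (suc k) = []
choose (x ∷ xs) (suc k) = map (x ∷_) (choose xs k) ++ choose xs (suc k)

rSets : (n r : ℕ) → List (Subset n)
rSets n r = filter (λ e → ∣ e ∣ ≟ r) (allSubsets n)

-- H_r(n,m): r-uniform hypergraphs on [n] with exactly m edges
-- (each listed once, as the list of its edges)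
Hyp : (n r m : ℕ) → List (List (Subset n))
Hyp n r m = choose (rSets n r) m

union : {n : ℕ} → List (Subset n) → Subset n
union = foldr _∪_ ⊥

countSets : {n : ℕ} → (r t α : ℕ) → List (Subset n) → ℕ
countSets r t α H = length (filter (λ F → ∣ union F ∣ ≤? r * t ∸ α) (choose H t))

-- sum over all H in H_r(n,m) of countSets; the expectation is
-- totalCount / length (Hyp n r m)
totalCount : (n r m t α : ℕ) → ℕ
totalCount n r m t α = sum (map (countSets r t α) (Hyp n r m))

module Submission where

-- Double counting writes the total count as C(N − t, m − t) · B, where N = C(n, r) and B is the
-- number of t-sets of r-subsets of [n] whose union has at most r t − α vertices; moreover
-- C(N − t, m − t) · N^t ≤ m^t · C(N, m). B is at most the number of such ordered t-tuples, built
-- one edge at a time: an edge meeting the current union U in at least j vertices can be chosen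
-- in at most C(∣U∣, j) · C(n − j, r − j) ≤ C(n, r) · (∣U∣ r)^j / (j! n^j) ways. Distributing the
-- deficiency α over the t edges and summing with the binomial theorem gives
-- B · n^α · α! ≤ N^t (r² t²)^α, and t^α ≤ T^T · α! absorbs the factorial.

open import Defs
open import Data.Bool using (if_then_else_)
open import Data.Fin as Fin using (Fin; toℕ)
open import Data.Fin.Subset using (Subset; ∣_∣; _∪_; _∩_; ⊥; inside; outside)
open import Data.Fin.Subset.Properties using (∪-assoc; ∪-identityˡ; ∪-identityʳ; ∣⊥∣≡0)
open import Data.List using (List; []; _∷_; map; _++_; filter; length)
open import Data.List.Membership.Propositional using (_∈_)
open import Data.List.Membership.Propositional.Properties using (∈-filter⁻)
open import Data.List.Properties using (length-++; length-map)
open import Data.List.Relation.Unary.Any using (here; there)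
open import Data.Nat
open import Data.Nat.Combinatorics using (_C_; nCn≡1; nC1≡n; nCk+nC[k+1]≡[n+1]C[k+1])
open import Data.Nat.ListAction using (sum)
open import Data.Nat.Properties
open import Data.Nat.Tactic.RingSolver using (solve-∀)
open import Data.Product using (Σ; _,_; proj₁; proj₂)
open import Data.Vec using (_∷_; [])
open import Function using (_∘_)
open import Relation.Binary.PropositionalEquality
open import Relation.Nullary using (Dec; yes; no; does; ¬_; contradiction)
open import Relation.Unary using (Pred; Decidable)

open import Algebra.Properties.CommutativeSemigroup *-commutativeSemigroup
  using (x∙yz≈y∙xz; xy∙z≈y∙xz; x∙yz≈z∙xy)
import Algebra.Properties.CommutativeSemigroup +-commutativeSemigroup as +-Semigroup
import Algebra.Definitions.RawSemiring +-*-rawSemiring as Raw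
import Algebra.Properties.CommutativeSemiring.Binomial +-*-commutativeSemiring as Binomial
import Algebra.Properties.CommutativeSemiring.Exp +-*-commutativeSemiring as Exp
open import Algebra.Properties.Semiring.Sum +-*-semiring
  using (sum⁺-syntax; sum-cong-≗; sum-replicate-zero; *-distribˡ-sum)
  renaming (sum to ∑ᶠ)

𝟙 : ∀ {p} {P : Set p} → Dec P → ℕ
𝟙 d = if does d then 1 else 0

𝟙≤1 : ∀ {p} {P : Set p} (P? : Dec P) → 𝟙 P? ≤ 1
𝟙≤1 (yes _) = ≤-refl
𝟙≤1 (no _) = z≤n

𝟙-true : ∀ {p} {P : Set p} (P? : Dec P) → P → 𝟙 P? ≡ 1
𝟙-true (yes _) _ = refl
𝟙-true (no ¬p) p = contradiction p ¬p

𝟙-false : ∀ {p} {P : Set p} (P? : Dec P) → ¬ P → 𝟙 P? ≡ 0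
𝟙-false (yes p) ¬p = contradiction p ¬p
𝟙-false (no _) _ = refl

𝟙-mono : ∀ {p q} {P : Set p} {Q : Set q} (P? : Dec P) (Q? : Dec Q) → (P → Q) → 𝟙 P? ≤ 𝟙 Q?
𝟙-mono (no _) _ _ = z≤n
𝟙-mono (yes _) (yes _) _ = ≤-refl
𝟙-mono (yes p) (no ¬q) P⇒Q = contradiction (P⇒Q p) ¬q

𝟙-≤?-suc : ∀ m n → 𝟙 (suc m ≤? suc n) ≡ 𝟙 (m ≤? n)
𝟙-≤?-suc m n = ≤-antisym (𝟙-mono (suc m ≤? suc n) (m ≤? n) s≤s⁻¹) (𝟙-mono (m ≤? n) (suc m ≤? suc n) s≤s)

∑ : {A : Set} → List A → (A → ℕ) → ℕ
∑ xs f = sum (map f xs)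

syntax ∑ xs (λ x → e) = ∑[ x ∈ xs ] e

module _ {A : Set} where

  ∑-++ : ∀ (xs ys : List A) f → ∑ (xs ++ ys) f ≡ ∑ xs f + ∑ ys f
  ∑-++ [] ys f = refl
  ∑-++ (x ∷ xs) ys f = trans (cong (f x +_) (∑-++ xs ys f)) (sym (+-assoc (f x) _ _))

  ∑-mono-∈ : ∀ (xs : List A) {f g} → (∀ {x} → x ∈ xs → f x ≤ g x) → ∑ xs f ≤ ∑ xs g
  ∑-mono-∈ [] _ = z≤n
  ∑-mono-∈ (x ∷ xs) f≤g = +-mono-≤ (f≤g (here refl)) (∑-mono-∈ xs (f≤g ∘ there))

  ∑-mono : ∀ (xs : List A) {f g} → (∀ x → f x ≤ g x) → ∑ xs f ≤ ∑ xs g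
  ∑-mono xs f≤g = ∑-mono-∈ xs (λ {x} _ → f≤g x)

  ∑-cong : ∀ (xs : List A) {f g} → (∀ x → f x ≡ g x) → ∑ xs f ≡ ∑ xs g
  ∑-cong [] _ = refl
  ∑-cong (x ∷ xs) f≗g = cong₂ _+_ (f≗g x) (∑-cong xs f≗g)

  ∑-zero : ∀ (xs : List A) → ∑[ x ∈ xs ] 0 ≡ 0
  ∑-zero [] = refl
  ∑-zero (x ∷ xs) = ∑-zero xs

  ∑-const : ∀ (xs : List A) c → ∑[ x ∈ xs ] c ≡ length xs * c
  ∑-const [] c = refl
  ∑-const (x ∷ xs) c = cong (c +_) (∑-const xs c)

  ∑-distrib-+ : ∀ (xs : List A) f g → ∑[ x ∈ xs ] (f x + g x) ≡ ∑ xs f + ∑ xs g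
  ∑-distrib-+ [] f g = refl
  ∑-distrib-+ (x ∷ xs) f g = trans (cong (f x + g x +_) (∑-distrib-+ xs f g))
    (+-Semigroup.interchange (f x) (g x) (∑ xs f) (∑ xs g))

  *-distribʳ-∑ : ∀ (xs : List A) c f → ∑ xs f * c ≡ ∑[ x ∈ xs ] (f x * c)
  *-distribʳ-∑ [] c f = refl
  *-distribʳ-∑ (x ∷ xs) c f = trans (*-distribʳ-+ c (f x) _) (cong (f x * c +_) (*-distribʳ-∑ xs c f))

  ∑-filter : ∀ {ℓ} {P : Pred A ℓ} (P? : Decidable P) (xs : List A) f →
    ∑ (filter P? xs) f ≡ ∑[ x ∈ xs ] (𝟙 (P? x) * f x)
  ∑-filter P? [] f = refl
  ∑-filter P? (x ∷ xs) f with P? x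
  ... | yes _ = cong₂ _+_ (sym (+-identityʳ (f x))) (∑-filter P? xs f)
  ... | no _ = ∑-filter P? xs f

  length-filter : ∀ {ℓ} {P : Pred A ℓ} (P? : Decidable P) (xs : List A) →
    length (filter P? xs) ≡ ∑[ x ∈ xs ] 𝟙 (P? x)
  length-filter P? [] = refl
  length-filter P? (x ∷ xs) with P? x
  ... | yes _ = cong suc (length-filter P? xs)
  ... | no _ = length-filter P? xs

  ∑-map : ∀ {B : Set} (g : B → A) (xs : List B) f → ∑ (map g xs) f ≡ ∑ xs (f ∘ g)
  ∑-map g [] f = refl
  ∑-map g (x ∷ xs) f = cong (f (g x) +_) (∑-map g xs f)

∑ᶠ-distrib-+ : ∀ {n} (f g : Fin n → ℕ) → ∑ᶠ (λ i → f i + g i) ≡ ∑ᶠ f + ∑ᶠ g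
∑ᶠ-distrib-+ {zero} f g = refl
∑ᶠ-distrib-+ {suc n} f g =
  trans (cong (f Fin.zero + g Fin.zero +_) (∑ᶠ-distrib-+ (f ∘ Fin.suc) (g ∘ Fin.suc)))
        (+-Semigroup.interchange (f Fin.zero) (g Fin.zero) (∑ᶠ (f ∘ Fin.suc)) (∑ᶠ (g ∘ Fin.suc)))

∑ᶠ-mono : ∀ {n} {f g : Fin n → ℕ} → (∀ i → f i ≤ g i) → ∑ᶠ f ≤ ∑ᶠ g
∑ᶠ-mono {zero} _ = z≤n
∑ᶠ-mono {suc n} f≤g = +-mono-≤ (f≤g Fin.zero) (∑ᶠ-mono (f≤g ∘ Fin.suc))

≤-∑ᶠ : ∀ (f : ℕ → ℕ) {k β} → k ≤ β → f k ≤ ∑[ j ≤ β ] f (toℕ j)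
≤-∑ᶠ f {zero} _ = m≤m+n _ _
≤-∑ᶠ f {suc k} {suc β} (s≤s k≤β) =
  ≤-trans (≤-∑ᶠ (f ∘ suc) k≤β) (m≤n+m (∑[ j ≤ β ] f (suc (toℕ j))) (f 0))

∑-∑ᶠ-comm : ∀ {A : Set} (xs : List A) {n} (f : A → Fin n → ℕ) →
  ∑[ x ∈ xs ] ∑ᶠ (f x) ≡ ∑ᶠ (λ i → ∑[ x ∈ xs ] f x i)
∑-∑ᶠ-comm [] {n} f = sym (sum-replicate-zero n)
∑-∑ᶠ-comm (x ∷ xs) f = trans (cong (∑ᶠ (f x) +_) (∑-∑ᶠ-comm xs f))
  (sym (∑ᶠ-distrib-+ (f x) (λ i → ∑[ y ∈ xs ] f y i)))

-- Pascal's recursion; unlike the division-based _C_ it computes on open terms.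
binom : ℕ → ℕ → ℕ
binom zero zero = 1
binom zero (suc k) = 0
binom (suc n) zero = 1
binom (suc n) (suc k) = binom n k + binom n (suc k)

binom≡C : ∀ n k → binom n k ≡ n C k
binom≡C zero zero = refl
binom≡C zero (suc k) = refl
binom≡C (suc n) zero = refl
binom≡C (suc n) (suc k) =
  trans (cong₂ _+_ (binom≡C n k) (binom≡C n (suc k))) (nCk+nC[k+1]≡[n+1]C[k+1] n k)

binom[n,0]≡1 : ∀ n → binom n 0 ≡ 1
binom[n,0]≡1 zero = refl
binom[n,0]≡1 (suc n) = refl

binom[n,1]≡n : ∀ n → binom n 1 ≡ n
binom[n,1]≡n n = trans (binom≡C n 1) (nC1≡n n)

binom[n,n]≡1 : ∀ n → binom n n ≡ 1
binom[n,n]≡1 n = trans (binom≡C n n) (nCn≡1 n)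

binom-pos : ∀ {n k} → k ≤ n → 0 < binom n k
binom-pos {n} {zero} _ = ≤-reflexive (sym (binom[n,0]≡1 n))
binom-pos {suc n} {suc k} (s≤s k≤n) = ≤-trans (binom-pos k≤n) (m≤m+n _ _)

binom-suc-mono : ∀ n k → binom n k ≤ binom (suc n) k
binom-suc-mono zero zero = ≤-refl
binom-suc-mono zero (suc k) = z≤n
binom-suc-mono (suc n) zero = ≤-refl
binom-suc-mono (suc n) (suc k) = m≤n+m (binom (suc n) (suc k)) (binom (suc n) k)

binom-absorb : ∀ n k → binom (suc n) (suc k) * suc k ≡ binom n k * suc n
binom-absorb zero zero = refl
binom-absorb zero (suc k) = refl
binom-absorb (suc n) zero rewrite binom[n,1]≡n (suc n) =
  cong (suc ∘ suc) (trans (*-identityʳ n) (sym (+-identityʳ n)))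
binom-absorb (suc n) (suc k) = begin
  (a + b) * suc (suc k)           ≡⟨ split a b k ⟩
  a * suc k + a + b * suc (suc k) ≡⟨ cong₂ (λ u v → u + a + v) (binom-absorb n k) (binom-absorb n (suc k)) ⟩
  c * suc n + (c + d) + d * suc n ≡⟨ merge c d n ⟩
  (c + d) * suc (suc n)           ∎
  where
  open ≡-Reasoning
  a = binom (suc n) (suc k)
  b = binom (suc n) (suc (suc k))
  c = binom n k
  d = binom n (suc k)
  split : ∀ a b k → (a + b) * suc (suc k) ≡ a * suc k + a + b * suc (suc k)
  split = solve-∀
  merge : ∀ c d n → c * suc n + (c + d) + d * suc n ≡ (c + d) * suc (suc n)
  merge = solve-∀

binom*!≤^ : ∀ n k → binom n k * k ! ≤ n ^ k
binom*!≤^ zero zero = ≤-refl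
binom*!≤^ zero (suc k) = z≤n
binom*!≤^ (suc n) zero = ≤-refl
binom*!≤^ (suc n) (suc k) = begin
  binom (suc n) (suc k) * (suc k * k !) ≡⟨ sym (*-assoc (binom (suc n) (suc k)) (suc k) (k !)) ⟩
  binom (suc n) (suc k) * suc k * k !   ≡⟨ cong (_* k !) (binom-absorb n k) ⟩
  binom n k * suc n * k !               ≡⟨ xy∙z≈y∙xz (binom n k) (suc n) (k !) ⟩
  suc n * (binom n k * k !)             ≤⟨ *-monoʳ-≤ (suc n) (≤-trans (binom*!≤^ n k) (^-monoˡ-≤ k (n≤1+n n))) ⟩
  suc n * suc n ^ k                     ∎
  where open ≤-Reasoning

binom*!*!≡! : ∀ {n k} → k ≤ n → binom n k * (k ! * (n ∸ k) !) ≡ n !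
binom*!*!≡! {n} {k} k≤n with m≤n⇒∃[o]m+o≡n k≤n
... | s , refl rewrite m+n∸m≡n k s = go k
  where
  go : ∀ k → binom (k + s) k * (k ! * s !) ≡ (k + s) !
  go zero = trans (cong (_* (1 * s !)) (binom[n,0]≡1 s)) (trans (*-identityˡ _) (*-identityˡ _))
  go (suc k) = begin
    binom (suc (k + s)) (suc k) * (suc k * k ! * s !) ≡⟨ regroup (binom (suc (k + s)) (suc k)) (suc k) (k !) (s !) ⟩
    binom (suc (k + s)) (suc k) * suc k * (k ! * s !) ≡⟨ cong (_* (k ! * s !)) (binom-absorb (k + s) k) ⟩
    binom (k + s) k * suc (k + s) * (k ! * s !)       ≡⟨ xy∙z≈y∙xz (binom (k + s) k) (suc (k + s)) (k ! * s !) ⟩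
    suc (k + s) * (binom (k + s) k * (k ! * s !))     ≡⟨ cong (suc (k + s) *_) (go k) ⟩
    suc (k + s) * (k + s) !                           ∎
    where
    open ≡-Reasoning
    regroup : ∀ a b c d → a * (b * c * d) ≡ a * b * (c * d)
    regroup = solve-∀

^*!-split : ∀ x {β k} → k ≤ β →
  x ^ β * β ! ≡ (x ^ (β ∸ k) * (β ∸ k) !) * (x ^ k * k ! * binom β k)
^*!-split x {β} {k} k≤β = begin
  x ^ β * β !
    ≡⟨ cong₂ _*_ (cong (x ^_) β≡k+[β∸k]) (sym (binom*!*!≡! k≤β)) ⟩
  x ^ (k + (β ∸ k)) * (binom β k * (k ! * (β ∸ k) !))
    ≡⟨ cong (_* _) (^-distribˡ-+-* x k (β ∸ k)) ⟩
  x ^ k * x ^ (β ∸ k) * (binom β k * (k ! * (β ∸ k) !))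
    ≡⟨ regroup (x ^ k) (x ^ (β ∸ k)) (binom β k) (k !) ((β ∸ k) !) ⟩
  (x ^ (β ∸ k) * (β ∸ k) !) * (x ^ k * k ! * binom β k)
    ∎
  where
  open ≡-Reasoning
  β≡k+[β∸k] : β ≡ k + (β ∸ k)
  β≡k+[β∸k] = sym (m+[n∸m]≡n k≤β)
  regroup : ∀ a b c d e → a * b * (c * (d * e)) ≡ (b * e) * (a * d * c)
  regroup = solve-∀

^≤^*! : ∀ x a → x ^ a ≤ x ^ x * a !
^≤^*! x zero = ≤-trans (1≤x^x x) (≤-reflexive (sym (*-identityʳ _)))
  where
  1≤x^x : ∀ x → 1 ≤ x ^ x
  1≤x^x zero = ≤-refl
  1≤x^x (suc x) = m^n>0 (suc x) (suc x)
^≤^*! x (suc a) with suc a ≤? x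
... | yes a<x = begin
  x ^ suc a       ≤⟨ ^-monoʳ-≤ x {{>-nonZero (≤-trans (s≤s z≤n) a<x)}} a<x ⟩
  x ^ x           ≤⟨ m≤m*n (x ^ x) (suc a !) {{suc a !≢0}} ⟩
  x ^ x * suc a ! ∎
  where open ≤-Reasoning
... | no a≮x = begin
  x * x ^ a             ≤⟨ *-mono-≤ (<⇒≤ (≰⇒> a≮x)) (^≤^*! x a) ⟩
  suc a * (x ^ x * a !) ≡⟨ x∙yz≈y∙xz (suc a) (x ^ x) (a !) ⟩
  x ^ x * (suc a * a !) ∎
  where open ≤-Reasoning

Raw-×≡* : ∀ k x → k Raw.× x ≡ k * x
Raw-×≡* zero x = refl
Raw-×≡* (suc k) x = cong (x +_) (Raw-×≡* k x)

Raw-^≡^ : ∀ x k → x Raw.^ k ≡ x ^ k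
Raw-^≡^ x zero = refl
Raw-^≡^ x (suc k) = cong (x *_) (Raw-^≡^ x k)

^-distribʳ-* : ∀ x y k → (x * y) ^ k ≡ x ^ k * y ^ k
^-distribʳ-* x y k = trans (sym (Raw-^≡^ (x * y) k))
  (trans (Exp.^-distrib-* x y k) (cong₂ _*_ (Raw-^≡^ x k) (Raw-^≡^ y k)))

binomial-theorem : ∀ n x y →
  (x + y) ^ n ≡ ∑[ k ≤ n ] (binom n (toℕ k) * (x ^ toℕ k * y ^ (n ∸ toℕ k)))
binomial-theorem n x y =
  trans (sym (Raw-^≡^ (x + y) n)) (trans (Binomial.theorem n x y) (sum-cong-≗ {suc n} term))
  where
  term : ∀ k → (n C toℕ k) Raw.× (x Raw.^ toℕ k * y Raw.^ (n ∸ toℕ k))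
             ≡ binom n (toℕ k) * (x ^ toℕ k * y ^ (n ∸ toℕ k))
  term k = trans (Raw-×≡* (n C toℕ k) _)
    (cong₂ _*_ (sym (binom≡C n (toℕ k))) (cong₂ _*_ (Raw-^≡^ x (toℕ k)) (Raw-^≡^ y (n ∸ toℕ k))))

-- The number of m-subsets of an a-set containing a fixed t-subset: C(a − t, m − t) when
-- t ≤ m and t ≤ a, and 0 otherwise.
supersets : ℕ → ℕ → ℕ → ℕ
supersets a m zero = binom a m
supersets a zero (suc t) = 0
supersets zero (suc m) (suc t) = 0
supersets (suc a) (suc m) (suc t) = supersets a m t

supersets-suc-mono : ∀ a m t → supersets a m t ≤ supersets (suc a) m t
supersets-suc-mono a m zero = binom-suc-mono a m
supersets-suc-mono a zero (suc t) = z≤n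
supersets-suc-mono zero (suc m) (suc t) = z≤n
supersets-suc-mono (suc a) (suc m) (suc t) = supersets-suc-mono a m t

supersets-suc-suc≤ : ∀ a m t → supersets a (suc m) (suc t) ≤ supersets a m t
supersets-suc-suc≤ zero m t = z≤n
supersets-suc-suc≤ (suc a) m t = supersets-suc-mono a m t

supersets-pascal-≤ : ∀ a m t → supersets a m t + supersets a (suc m) t ≤ supersets (suc a) (suc m) t
supersets-pascal-≤ a m zero = ≤-refl
supersets-pascal-≤ a zero (suc t) = supersets-suc-suc≤ a 0 t
supersets-pascal-≤ zero (suc m) (suc t) = z≤n
supersets-pascal-≤ (suc a) (suc m) (suc t) = supersets-pascal-≤ a m t

supersets-pascal : ∀ a m t → suc t ≤ a →
  supersets a m (suc t) + supersets a (suc m) (suc t) ≡ supersets a m t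
supersets-pascal (suc a) zero zero _ = binom[n,0]≡1 a
supersets-pascal (suc a) (suc m) zero _ = refl
supersets-pascal (suc a) zero (suc t) _ = refl
supersets-pascal (suc a) (suc m) (suc t) (s≤s t<a) = supersets-pascal a m t t<a

binom-ratio : ∀ {x y} a m → x * suc m ≤ y * suc a → x * binom a m ≤ y * binom (suc a) (suc m)
binom-ratio {x} {y} a m xm≤ya = *-cancelʳ-≤ _ _ (suc m) (begin
  x * binom a m * suc m               ≡⟨ xy∙z≈y∙xz x (binom a m) (suc m) ⟩
  binom a m * (x * suc m)             ≤⟨ *-monoʳ-≤ (binom a m) xm≤ya ⟩
  binom a m * (y * suc a)             ≡⟨ x∙yz≈y∙xz (binom a m) y (suc a) ⟩
  y * (binom a m * suc a)             ≡⟨ cong (y *_) (sym (binom-absorb a m)) ⟩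
  y * (binom (suc a) (suc m) * suc m) ≡⟨ sym (*-assoc y _ (suc m)) ⟩
  y * binom (suc a) (suc m) * suc m   ∎)
  where open ≤-Reasoning

-- For x = a and y = m this is C(a − t, m − t) · a^t ≤ m^t · C(a, m). The induction passes from
-- (a, m) to (a − 1, m − 1) with x and y unchanged, hence the general ratio.
supersets-bound : ∀ a m t {x y} → y ≤ x → x * m ≤ y * a →
  supersets a m t * x ^ t ≤ y ^ t * binom a m
supersets-bound a m zero _ _ = ≤-reflexive (trans (*-identityʳ _) (sym (*-identityˡ _)))
supersets-bound a zero (suc t) _ _ = z≤n
supersets-bound zero (suc m) (suc t) _ _ = z≤n
supersets-bound (suc a) (suc m) (suc t) {x} {y} y≤x x[m+1]≤y[a+1] = begin
  supersets a m t * (x * x ^ t)       ≡⟨ x∙yz≈y∙xz (supersets a m t) x (x ^ t) ⟩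
  x * (supersets a m t * x ^ t)       ≤⟨ *-monoʳ-≤ x (supersets-bound a m t y≤x xm≤ya) ⟩
  x * (y ^ t * binom a m)             ≡⟨ x∙yz≈y∙xz x (y ^ t) (binom a m) ⟩
  y ^ t * (x * binom a m)             ≤⟨ *-monoʳ-≤ (y ^ t) (binom-ratio {x} {y} a m x[m+1]≤y[a+1]) ⟩
  y ^ t * (y * binom (suc a) (suc m)) ≡⟨ sym (xy∙z≈y∙xz y (y ^ t) _) ⟩
  y * y ^ t * binom (suc a) (suc m)   ∎
  where
  open ≤-Reasoning
  xm≤ya : x * m ≤ y * a
  xm≤ya = +-cancelˡ-≤ x _ _ (begin
    x + x * m ≡⟨ sym (*-suc x m) ⟩
    x * suc m ≤⟨ x[m+1]≤y[a+1] ⟩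
    y * suc a ≡⟨ *-suc y a ⟩
    y + y * a ≤⟨ +-monoˡ-≤ (y * a) y≤x ⟩
    x + y * a ∎)

supersets-bound-diag : ∀ {a m} t → m ≤ a → supersets a m t * a ^ t ≤ m ^ t * binom a m
supersets-bound-diag {a} {m} t m≤a = supersets-bound a m t m≤a (≤-reflexive (*-comm a m))

-- Double counting

module _ {A : Set} where

  ∑-choose-suc : ∀ x (xs : List A) k g →
    ∑ (choose (x ∷ xs) (suc k)) g ≡ ∑[ F ∈ choose xs k ] g (x ∷ F) + ∑ (choose xs (suc k)) g
  ∑-choose-suc x xs k g = trans (∑-++ (map (x ∷_) (choose xs k)) _ g)
    (cong (_+ ∑ (choose xs (suc k)) g) (∑-map (x ∷_) (choose xs k) g))

  length-choose : ∀ (xs : List A) k → length (choose xs k) ≡ binom (length xs) k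
  length-choose xs zero = sym (binom[n,0]≡1 (length xs))
  length-choose [] (suc k) = refl
  length-choose (x ∷ xs) (suc k) = begin
    length (map (x ∷_) (choose xs k) ++ choose xs (suc k))          ≡⟨ length-++ (map (x ∷_) (choose xs k)) ⟩
    length (map (x ∷_) (choose xs k)) + length (choose xs (suc k)) ≡⟨ cong (_+ _) (length-map (x ∷_) (choose xs k)) ⟩
    length (choose xs k) + length (choose xs (suc k))               ≡⟨ cong₂ _+_ (length-choose xs k) (length-choose xs (suc k)) ⟩
    binom (length xs) k + binom (length xs) (suc k)                 ∎
    where open ≡-Reasoning

  choose-≡-[] : ∀ (xs : List A) k → length xs < k → choose xs k ≡ []
  choose-≡-[] [] (suc k) _ = refl
  choose-≡-[] (x ∷ xs) (suc k) (s≤s |xs|<k)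
    rewrite choose-≡-[] xs k |xs|<k | choose-≡-[] xs (suc k) (m<n⇒m<1+n |xs|<k) = refl

  ∑-choose-choose : ∀ (xs : List A) m t g →
    ∑[ H ∈ choose xs m ] ∑ (choose H t) g ≡ supersets (length xs) m t * ∑ (choose xs t) g
  ∑-choose-choose xs zero zero g rewrite binom[n,0]≡1 (length xs) = refl
  ∑-choose-choose xs zero (suc t) g = refl
  ∑-choose-choose xs (suc m) zero g =
    trans (∑-const (choose xs (suc m)) _) (cong (_* _) (length-choose xs (suc m)))
  ∑-choose-choose [] (suc m) (suc t) g = refl
  ∑-choose-choose (x ∷ xs) (suc m) (suc t) g = begin
    ∑ (choose (x ∷ xs) (suc m)) ∑⁺
      ≡⟨ ∑-choose-suc x xs m ∑⁺ ⟩
    ∑[ H ∈ choose xs m ] ∑⁺ (x ∷ H) + ∑ (choose xs (suc m)) ∑⁺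
      ≡⟨ cong (_+ ∑ (choose xs (suc m)) ∑⁺)
           (trans (∑-cong (choose xs m) (λ H → ∑-choose-suc x H t g)) (∑-distrib-+ (choose xs m) _ _)) ⟩
    (∑[ H ∈ choose xs m ] ∑ (choose H t) gₓ + ∑ (choose xs m) ∑⁺) + ∑ (choose xs (suc m)) ∑⁺
      ≡⟨ cong₂ _+_ (cong₂ _+_ (∑-choose-choose xs m t gₓ) (∑-choose-choose xs m (suc t) g))
                   (∑-choose-choose xs (suc m) (suc t) g) ⟩
    (supersets a m t * Sₓ + supersets a m (suc t) * S) + supersets a (suc m) (suc t) * S
      ≡⟨ regroup (supersets a m t) Sₓ (supersets a m (suc t)) S (supersets a (suc m) (suc t)) ⟩
    supersets a m t * Sₓ + (supersets a m (suc t) + supersets a (suc m) (suc t)) * S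
      ≡⟨ cong (supersets a m t * Sₓ +_) pascal ⟩
    supersets a m t * Sₓ + supersets a m t * S
      ≡⟨ sym (*-distribˡ-+ (supersets a m t) Sₓ S) ⟩
    supersets a m t * (Sₓ + S)
      ≡⟨ cong (supersets a m t *_) (sym (∑-choose-suc x xs t g)) ⟩
    supersets a m t * ∑ (choose (x ∷ xs) (suc t)) g
      ∎
    where
    open ≡-Reasoning
    a = length xs
    ∑⁺ = λ H → ∑ (choose H (suc t)) g
    gₓ = λ F → g (x ∷ F)
    Sₓ = ∑ (choose xs t) gₓ
    S = ∑ (choose xs (suc t)) g
    regroup : ∀ k₁ a k₂ b k₃ → (k₁ * a + k₂ * b) + k₃ * b ≡ k₁ * a + (k₂ + k₃) * b
    regroup = solve-∀
    pascal : (supersets a m (suc t) + supersets a (suc m) (suc t)) * S ≡ supersets a m t * S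
    pascal with suc t ≤? a
    ... | yes t<a = cong (_* S) (supersets-pascal a m t t<a)
    ... | no t≮a rewrite choose-≡-[] xs (suc t) (≰⇒> t≮a) =
      trans (*-zeroʳ (supersets a m (suc t) + supersets a (suc m) (suc t))) (sym (*-zeroʳ (supersets a m t)))

  ∑-tuples : List A → ℕ → (List A → ℕ) → ℕ
  ∑-tuples xs zero h = h []
  ∑-tuples xs (suc t) h = ∑[ x ∈ xs ] ∑-tuples xs t (λ F → h (x ∷ F))

  ∑-tuples-mono : ∀ (xs : List A) t {h h′} → (∀ F → h F ≤ h′ F) → ∑-tuples xs t h ≤ ∑-tuples xs t h′
  ∑-tuples-mono xs zero h≤h′ = h≤h′ []
  ∑-tuples-mono xs (suc t) h≤h′ = ∑-mono xs (λ x → ∑-tuples-mono xs t (λ F → h≤h′ (x ∷ F)))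

  ∑-tuples-≤-^ : ∀ (xs : List A) t h → (∀ F → h F ≤ 1) → ∑-tuples xs t h ≤ length xs ^ t
  ∑-tuples-≤-^ xs zero h h≤1 = h≤1 []
  ∑-tuples-≤-^ xs (suc t) h h≤1 = begin
    ∑[ x ∈ xs ] ∑-tuples xs t (λ F → h (x ∷ F)) ≤⟨ ∑-mono xs (λ x → ∑-tuples-≤-^ xs t _ (λ F → h≤1 (x ∷ F))) ⟩
    ∑[ x ∈ xs ] (length xs ^ t)                 ≡⟨ ∑-const xs (length xs ^ t) ⟩
    length xs * length xs ^ t                   ∎
    where open ≤-Reasoning

  ∑-tuples-∷ : ∀ x (xs : List A) t h → ∑-tuples xs t h ≤ ∑-tuples (x ∷ xs) t h
  ∑-tuples-∷ x xs zero h = ≤-refl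
  ∑-tuples-∷ x xs (suc t) h = ≤-trans (∑-mono xs (λ y → ∑-tuples-∷ x xs t _))
    (m≤n+m _ (∑-tuples (x ∷ xs) t (λ F → h (x ∷ F))))

  ∑-choose≤∑-tuples : ∀ (xs : List A) t g → ∑ (choose xs t) g ≤ ∑-tuples xs t g
  ∑-choose≤∑-tuples xs zero g = ≤-reflexive (+-identityʳ (g []))
  ∑-choose≤∑-tuples [] (suc t) g = z≤n
  ∑-choose≤∑-tuples (x ∷ xs) (suc t) g = begin
    ∑ (choose (x ∷ xs) (suc t)) g
      ≡⟨ ∑-choose-suc x xs t g ⟩
    ∑[ F ∈ choose xs t ] g (x ∷ F) + ∑ (choose xs (suc t)) g
      ≤⟨ +-mono-≤ (∑-choose≤∑-tuples xs t _) (∑-choose≤∑-tuples xs (suc t) g) ⟩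
    ∑-tuples xs t (λ F → g (x ∷ F)) + ∑-tuples xs (suc t) g
      ≤⟨ +-mono-≤ (∑-tuples-∷ x xs t _) (∑-mono xs (λ y → ∑-tuples-∷ x xs t _)) ⟩
    ∑-tuples (x ∷ xs) (suc t) g
      ∎
    where open ≤-Reasoning

-- Counting edges by their overlap with a fixed set

∑-allSubsets-suc : ∀ n f → ∑ (allSubsets (suc n)) f ≡
  ∑[ e ∈ allSubsets n ] f (inside ∷ e) + ∑[ e ∈ allSubsets n ] f (outside ∷ e)
∑-allSubsets-suc n f = trans (∑-++ (map (inside ∷_) (allSubsets n)) _ f)
  (cong₂ _+_ (∑-map (inside ∷_) (allSubsets n) f) (∑-map (outside ∷_) (allSubsets n) f))

length-rSets : ∀ n r → length (rSets n r) ≡ binom n r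
length-rSets n r = trans (length-filter (λ e → ∣ e ∣ ≟ r) (allSubsets n)) (count n r)
  where
  count : ∀ n r → ∑[ e ∈ allSubsets n ] 𝟙 (∣ e ∣ ≟ r) ≡ binom n r
  count zero zero = refl
  count zero (suc r) = refl
  count (suc n) zero rewrite ∑-allSubsets-suc n (λ e → 𝟙 (∣ e ∣ ≟ 0)) | ∑-zero (allSubsets n) =
    trans (count n zero) (binom[n,0]≡1 n)
  count (suc n) (suc r) rewrite ∑-allSubsets-suc n (λ e → 𝟙 (∣ e ∣ ≟ suc r)) =
    cong₂ _+_ (count n r) (count n (suc r))

∣p∪q∣+∣p∩q∣≡∣p∣+∣q∣ : ∀ {n} (p q : Subset n) → ∣ p ∪ q ∣ + ∣ p ∩ q ∣ ≡ ∣ p ∣ + ∣ q ∣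
∣p∪q∣+∣p∩q∣≡∣p∣+∣q∣ [] [] = refl
∣p∪q∣+∣p∩q∣≡∣p∣+∣q∣ (inside ∷ p) (inside ∷ q) =
  cong suc (trans (+-suc _ _) (trans (cong suc (∣p∪q∣+∣p∩q∣≡∣p∣+∣q∣ p q)) (sym (+-suc _ _))))
∣p∪q∣+∣p∩q∣≡∣p∣+∣q∣ (inside ∷ p) (outside ∷ q) = cong suc (∣p∪q∣+∣p∩q∣≡∣p∣+∣q∣ p q)
∣p∪q∣+∣p∩q∣≡∣p∣+∣q∣ (outside ∷ p) (inside ∷ q) = trans (cong suc (∣p∪q∣+∣p∩q∣≡∣p∣+∣q∣ p q)) (sym (+-suc _ _))
∣p∪q∣+∣p∩q∣≡∣p∣+∣q∣ (outside ∷ p) (outside ∷ q) = ∣p∪q∣+∣p∩q∣≡∣p∣+∣q∣ p q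

overlapCount : (n : ℕ) → Subset n → ℕ → ℕ → ℕ
overlapCount n U r j = ∑[ e ∈ allSubsets n ] (𝟙 (∣ e ∣ ≟ r) * 𝟙 (j ≤? ∣ U ∩ e ∣))

overlapCount-bound : ∀ n (U : Subset n) r j → overlapCount n U r j ≤ binom ∣ U ∣ j * supersets n r j
overlapCount-bound zero [] zero zero = ≤-refl
overlapCount-bound zero [] zero (suc j) = z≤n
overlapCount-bound zero [] (suc r) j = z≤n
overlapCount-bound (suc n) (inside ∷ U) zero j
  rewrite ∑-allSubsets-suc n (λ e → 𝟙 (∣ e ∣ ≟ 0) * 𝟙 (j ≤? ∣ (inside ∷ U) ∩ e ∣)) | ∑-zero (allSubsets n) =
  ≤-trans (overlapCount-bound n U 0 j)
    (*-mono-≤ (binom-suc-mono ∣ U ∣ j) (supersets-suc-mono n 0 j))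
overlapCount-bound (suc n) (outside ∷ U) zero j
  rewrite ∑-allSubsets-suc n (λ e → 𝟙 (∣ e ∣ ≟ 0) * 𝟙 (j ≤? ∣ (outside ∷ U) ∩ e ∣)) | ∑-zero (allSubsets n) =
  ≤-trans (overlapCount-bound n U 0 j) (*-monoʳ-≤ (binom ∣ U ∣ j) (supersets-suc-mono n 0 j))
overlapCount-bound (suc n) (outside ∷ U) (suc r) j
  rewrite ∑-allSubsets-suc n (λ e → 𝟙 (∣ e ∣ ≟ suc r) * 𝟙 (j ≤? ∣ (outside ∷ U) ∩ e ∣)) = begin
  overlapCount n U r j + overlapCount n U (suc r) j
    ≤⟨ +-mono-≤ (overlapCount-bound n U r j) (overlapCount-bound n U (suc r) j) ⟩
  binom (∣ U ∣) j * supersets n r j + binom (∣ U ∣) j * supersets n (suc r) j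
    ≡⟨ sym (*-distribˡ-+ (binom (∣ U ∣) j) _ _) ⟩
  binom (∣ U ∣) j * (supersets n r j + supersets n (suc r) j)
    ≤⟨ *-monoʳ-≤ (binom (∣ U ∣) j) (supersets-pascal-≤ n r j) ⟩
  binom (∣ U ∣) j * supersets (suc n) (suc r) j
    ∎
  where open ≤-Reasoning
overlapCount-bound (suc n) (inside ∷ U) (suc r) zero
  rewrite ∑-allSubsets-suc n (λ e → 𝟙 (∣ e ∣ ≟ suc r) * 𝟙 (0 ≤? ∣ (inside ∷ U) ∩ e ∣)) = begin
  overlapCount n U r 0 + overlapCount n U (suc r) 0
    ≤⟨ +-mono-≤ (overlapCount-bound n U r 0) (overlapCount-bound n U (suc r) 0) ⟩
  binom (∣ U ∣) 0 * supersets n r 0 + binom (∣ U ∣) 0 * supersets n (suc r) 0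
    ≡⟨ cong₂ (λ a b → a * binom n r + b * binom n (suc r)) (binom[n,0]≡1 ∣ U ∣) (binom[n,0]≡1 ∣ U ∣) ⟩
  1 * binom n r + 1 * binom n (suc r)
    ≡⟨ sym (*-distribˡ-+ 1 (binom n r) _) ⟩
  1 * binom (suc n) (suc r)
    ∎
  where open ≤-Reasoning
overlapCount-bound (suc n) (inside ∷ U) (suc r) (suc j)
  rewrite ∑-allSubsets-suc n (λ e → 𝟙 (∣ e ∣ ≟ suc r) * 𝟙 (suc j ≤? ∣ (inside ∷ U) ∩ e ∣)) = begin
  ∑[ e ∈ allSubsets n ] (𝟙 (∣ e ∣ ≟ r) * 𝟙 (suc j ≤? suc ∣ U ∩ e ∣)) + overlapCount n U (suc r) (suc j)
    ≡⟨ cong (_+ overlapCount n U (suc r) (suc j))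
         (∑-cong (allSubsets n) (λ e → cong (𝟙 (∣ e ∣ ≟ r) *_) (𝟙-≤?-suc j ∣ U ∩ e ∣))) ⟩
  overlapCount n U r j + overlapCount n U (suc r) (suc j)
    ≤⟨ +-mono-≤ (overlapCount-bound n U r j)
         (≤-trans (overlapCount-bound n U (suc r) (suc j))
                  (*-monoʳ-≤ (binom (∣ U ∣) (suc j)) (supersets-suc-suc≤ n r j))) ⟩
  binom (∣ U ∣) j * supersets n r j + binom (∣ U ∣) (suc j) * supersets n r j
    ≡⟨ sym (*-distribʳ-+ (supersets n r j) (binom (∣ U ∣) j) _) ⟩
  binom (suc (∣ U ∣)) (suc j) * supersets n r j
    ∎
  where open ≤-Reasoning

overlap-bound : ∀ {n r} (U : Subset n) j → r ≤ n →
  (∑[ e ∈ rSets n r ] 𝟙 (j ≤? ∣ U ∩ e ∣)) * (n ^ j * j !) ≤ binom n r * (∣ U ∣ * r) ^ j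
overlap-bound {n} {r} U j r≤n = begin
  (∑[ e ∈ rSets n r ] 𝟙 (j ≤? ∣ U ∩ e ∣)) * (n ^ j * j !)
    ≡⟨ cong (_* (n ^ j * j !)) (∑-filter (λ e → ∣ e ∣ ≟ r) (allSubsets n) _) ⟩
  overlapCount n U r j * (n ^ j * j !)
    ≤⟨ *-monoˡ-≤ (n ^ j * j !) (overlapCount-bound n U r j) ⟩
  binom u j * supersets n r j * (n ^ j * j !)
    ≡⟨ regroup (binom u j) (supersets n r j) (n ^ j) (j !) ⟩
  (binom u j * j !) * (supersets n r j * n ^ j)
    ≤⟨ *-mono-≤ (binom*!≤^ u j) (supersets-bound-diag j r≤n) ⟩
  u ^ j * (r ^ j * binom n r)
    ≡⟨ x∙yz≈z∙xy (u ^ j) (r ^ j) (binom n r) ⟩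
  binom n r * (u ^ j * r ^ j)
    ≡⟨ cong (binom n r *_) (sym (^-distribʳ-* u r j)) ⟩
  binom n r * (u * r) ^ j
    ∎
  where
  open ≤-Reasoning
  u = ∣ U ∣
  regroup : ∀ a b c d → a * b * (c * d) ≡ (a * d) * (b * c)
  regroup = solve-∀


-- Tuples of edges with a large deficiency

module Deficiency {n r : ℕ} (r≤n : r ≤ n) (M : ℕ) where

  edges : List (Subset n)
  edges = rSets n r

  N : ℕ
  N = length edges

  Deficient : Subset n → ℕ → ℕ → List (Subset n) → Set
  Deficient U t β F = ∣ U ∪ union F ∣ + β ≤ ∣ U ∣ + r * t

  deficient? : ∀ U t β F → Dec (Deficient U t β F)
  deficient? U t β F = ∣ U ∪ union F ∣ + β ≤? ∣ U ∣ + r * t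

  deficientCount : Subset n → ℕ → ℕ → ℕ
  deficientCount U t β = ∑-tuples edges t (𝟙 ∘ deficient? U t β)

  ∣U∪e∣+∣U∩e∣≡∣U∣+r : ∀ (U e : Subset n) → ∣ e ∣ ≡ r → ∣ U ∪ e ∣ + ∣ U ∩ e ∣ ≡ ∣ U ∣ + r
  ∣U∪e∣+∣U∩e∣≡∣U∣+r U e ∣e∣≡r = trans (∣p∪q∣+∣p∩q∣≡∣p∣+∣q∣ U e) (cong (∣ U ∣ +_) ∣e∣≡r)

  deficient-∷ : ∀ U e {t β} F → ∣ e ∣ ≡ r → ∣ U ∩ e ∣ ≤ β →
    Deficient U (suc t) β (e ∷ F) → Deficient (U ∪ e) t (β ∸ ∣ U ∩ e ∣) F
  deficient-∷ U e {t} {β} F ∣e∣≡r k≤β deficient = +-cancelʳ-≤ k _ _ (begin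
    ∣ (U ∪ e) ∪ union F ∣ + (β ∸ k) + k ≡⟨ +-assoc ∣ (U ∪ e) ∪ union F ∣ (β ∸ k) k ⟩
    ∣ (U ∪ e) ∪ union F ∣ + (β ∸ k + k) ≡⟨ cong₂ (λ X b → ∣ X ∣ + b) (∪-assoc U e (union F)) (m∸n+n≡m k≤β) ⟩
    ∣ U ∪ (e ∪ union F) ∣ + β           ≤⟨ deficient ⟩
    ∣ U ∣ + r * suc t                   ≡⟨ cong (∣ U ∣ +_) (*-suc r t) ⟩
    ∣ U ∣ + (r + r * t)                 ≡⟨ sym (+-assoc ∣ U ∣ r (r * t)) ⟩
    ∣ U ∣ + r + r * t                   ≡⟨ cong (_+ r * t) (sym (∣U∪e∣+∣U∩e∣≡∣U∣+r U e ∣e∣≡r)) ⟩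
    ∣ U ∪ e ∣ + k + r * t               ≡⟨ +-Semigroup.xy∙z≈xz∙y ∣ U ∪ e ∣ k (r * t) ⟩
    ∣ U ∪ e ∣ + r * t + k               ∎)
    where
    open ≤-Reasoning
    k = ∣ U ∩ e ∣

  ∪-edge-fits : ∀ (U e : Subset n) t → ∣ e ∣ ≡ r → ∣ U ∣ + r * suc t ≤ M → ∣ U ∪ e ∣ + r * t ≤ M
  ∪-edge-fits U e t ∣e∣≡r fits = ≤-trans (begin
    ∣ U ∪ e ∣ + r * t             ≤⟨ +-monoˡ-≤ (r * t) (m≤m+n (∣ U ∪ e ∣) (∣ U ∩ e ∣)) ⟩
    ∣ U ∪ e ∣ + ∣ U ∩ e ∣ + r * t ≡⟨ cong (_+ r * t) (∣U∪e∣+∣U∩e∣≡∣U∣+r U e ∣e∣≡r) ⟩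
    ∣ U ∣ + r + r * t             ≡⟨ +-assoc ∣ U ∣ r (r * t) ⟩
    ∣ U ∣ + (r + r * t)           ≡⟨ cong (∣ U ∣ +_) (sym (*-suc r t)) ⟩
    ∣ U ∣ + r * suc t             ∎) fits
    where open ≤-Reasoning

  DeficiencyBound : ℕ → Set
  DeficiencyBound t = ∀ U β → ∣ U ∣ + r * t ≤ M →
    deficientCount U t β * (n ^ β * β !) ≤ N ^ t * (M * r * t) ^ β

  deficiencyBound-zero : DeficiencyBound 0
  deficiencyBound-zero U zero _ = ≤-trans (≤-reflexive (*-identityʳ (𝟙 U-deficient?))) (𝟙≤1 U-deficient?)
    where U-deficient? = deficient? U 0 0 []
  deficiencyBound-zero U (suc β) _ =
    ≤-trans (≤-reflexive (cong (_* (n ^ suc β * suc β !)) (𝟙-false (deficient? U 0 (suc β) []) impossible))) z≤n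
    where
    impossible : ¬ Deficient U 0 (suc β) []
    impossible p rewrite ∪-identityʳ U | *-zeroʳ r | +-identityʳ ∣ U ∣ = m+1+n≰m ∣ U ∣ p

  charge : ℕ → Subset n → ℕ → Subset n → ℕ → ℕ
  charge t U β e j = 𝟙 (j ≤? ∣ U ∩ e ∣) * (n ^ j * j ! * (binom β j * (N ^ t * (M * r * t) ^ (β ∸ j))))

  -- An edge e meeting U in k ≤ β vertices leaves deficiency β − k to the other t edges, which
  -- gives the j = k term; if k > β the trivial bound N^t is the j = β term.
  extension-bound : ∀ {t} → DeficiencyBound t → ∀ U β e → ∣ e ∣ ≡ r → ∣ U ∣ + r * suc t ≤ M →
    ∑-tuples edges t (λ F → 𝟙 (deficient? U (suc t) β (e ∷ F))) * (n ^ β * β !)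
      ≤ ∑[ j ≤ β ] charge t U β e (toℕ j)
  extension-bound {t} bound U β e ∣e∣≡r fits with ∣ U ∩ e ∣ ≤? β
  ... | yes k≤β = begin
    ∑-tuples edges t (λ F → 𝟙 (deficient? U (suc t) β (e ∷ F))) * (n ^ β * β !)
      ≤⟨ *-monoˡ-≤ (n ^ β * β !) (∑-tuples-mono edges t (λ F → 𝟙-mono (deficient? U (suc t) β (e ∷ F))
                                                                         (deficient? (U ∪ e) t (β ∸ k) F)
                                                                         (deficient-∷ U e F ∣e∣≡r k≤β))) ⟩
    G * (n ^ β * β !)
      ≡⟨ cong (G *_) (^*!-split n k≤β) ⟩
    G * ((n ^ (β ∸ k) * (β ∸ k) !) * (n ^ k * k ! * binom β k))
      ≡⟨ sym (*-assoc G _ _) ⟩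
    G * (n ^ (β ∸ k) * (β ∸ k) !) * (n ^ k * k ! * binom β k)
      ≤⟨ *-monoˡ-≤ (n ^ k * k ! * binom β k) (bound (U ∪ e) (β ∸ k) (∪-edge-fits U e t ∣e∣≡r fits)) ⟩
    N ^ t * (M * r * t) ^ (β ∸ k) * (n ^ k * k ! * binom β k)
      ≡⟨ regroup (N ^ t) ((M * r * t) ^ (β ∸ k)) (n ^ k * k !) (binom β k) ⟩
    1 * (n ^ k * k ! * w)
      ≡⟨ cong (_* (n ^ k * k ! * w)) (sym (𝟙-true (k ≤? k) ≤-refl)) ⟩
    charge t U β e k
      ≤⟨ ≤-∑ᶠ (charge t U β e) {k} {β} k≤β ⟩
    ∑[ j ≤ β ] charge t U β e (toℕ j)
      ∎
    where
    open ≤-Reasoning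
    k = ∣ U ∩ e ∣
    G = deficientCount (U ∪ e) t (β ∸ k)
    w = binom β k * (N ^ t * (M * r * t) ^ (β ∸ k))
    regroup : ∀ a b c d → a * b * (c * d) ≡ 1 * (c * (d * (a * b)))
    regroup = solve-∀
  ... | no k≰β = begin
    ∑-tuples edges t (λ F → 𝟙 (deficient? U (suc t) β (e ∷ F))) * (n ^ β * β !)
      ≤⟨ *-monoˡ-≤ (n ^ β * β !) (∑-tuples-≤-^ edges t _ (λ F → 𝟙≤1 (deficient? U (suc t) β (e ∷ F)))) ⟩
    N ^ t * (n ^ β * β !)
      ≡⟨ sym charge-β ⟩
    charge t U β e β
      ≤⟨ ≤-∑ᶠ (charge t U β e) {β} ≤-refl ⟩
    ∑[ j ≤ β ] charge t U β e (toℕ j)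
      ∎
    where
    open ≤-Reasoning
    charge-β : charge t U β e β ≡ N ^ t * (n ^ β * β !)
    charge-β rewrite 𝟙-true (β ≤? ∣ U ∩ e ∣) (<⇒≤ (≰⇒> k≰β)) | binom[n,n]≡1 β | n∸n≡0 β =
      regroup (n ^ β) (β !) (N ^ t)
      where
      regroup : ∀ a b c → 1 * (a * b * (1 * (c * 1))) ≡ c * (a * b)
      regroup = solve-∀

  layer-bound : ∀ t U β j → ∣ U ∣ ≤ M →
    ∑[ e ∈ edges ] charge t U β e j ≤ N ^ suc t * (binom β j * ((M * r) ^ j * (M * r * t) ^ (β ∸ j)))
  layer-bound t U β j |U|≤M = begin
    ∑[ e ∈ edges ] (𝟙 (j ≤? ∣ U ∩ e ∣) * (n ^ j * j ! * w))
      ≡⟨ sym (*-distribʳ-∑ edges (n ^ j * j ! * w) (λ e → 𝟙 (j ≤? ∣ U ∩ e ∣))) ⟩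
    (∑[ e ∈ edges ] 𝟙 (j ≤? ∣ U ∩ e ∣)) * (n ^ j * j ! * w)
      ≡⟨ sym (*-assoc (∑[ e ∈ edges ] 𝟙 (j ≤? ∣ U ∩ e ∣)) (n ^ j * j !) w) ⟩
    (∑[ e ∈ edges ] 𝟙 (j ≤? ∣ U ∩ e ∣)) * (n ^ j * j !) * w
      ≤⟨ *-monoˡ-≤ w (overlap-bound U j r≤n) ⟩
    binom n r * (∣ U ∣ * r) ^ j * w
      ≤⟨ *-monoˡ-≤ w (*-mono-≤ (≤-reflexive (sym (length-rSets n r))) (^-monoˡ-≤ j (*-monoˡ-≤ r |U|≤M))) ⟩
    N * (M * r) ^ j * w
      ≡⟨ regroup N ((M * r) ^ j) (binom β j) (N ^ t) ((M * r * t) ^ (β ∸ j)) ⟩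
    N ^ suc t * (binom β j * ((M * r) ^ j * (M * r * t) ^ (β ∸ j)))
      ∎
    where
    open ≤-Reasoning
    w = binom β j * (N ^ t * (M * r * t) ^ (β ∸ j))
    regroup : ∀ a b c d e → a * b * (c * (d * e)) ≡ a * d * (c * (b * e))
    regroup = solve-∀

  deficiencyBound-suc : ∀ {t} → DeficiencyBound t → DeficiencyBound (suc t)
  deficiencyBound-suc {t} bound U β fits = begin
    deficientCount U (suc t) β * (n ^ β * β !)
      ≡⟨ *-distribʳ-∑ edges (n ^ β * β !) _ ⟩
    ∑[ e ∈ edges ] (∑-tuples edges t (λ F → 𝟙 (deficient? U (suc t) β (e ∷ F))) * (n ^ β * β !))
      ≤⟨ ∑-mono-∈ edges (λ {e} e∈edges → extension-bound bound U β e (∣e∣≡r e∈edges) fits) ⟩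
    ∑[ e ∈ edges ] (∑[ j ≤ β ] charge t U β e (toℕ j))
      ≡⟨ ∑-∑ᶠ-comm edges {suc β} (λ e j → charge t U β e (toℕ j)) ⟩
    ∑[ j ≤ β ] (∑[ e ∈ edges ] charge t U β e (toℕ j))
      ≤⟨ ∑ᶠ-mono {suc β} (λ j → layer-bound t U β (toℕ j) (m+n≤o⇒m≤o ∣ U ∣ fits)) ⟩
    ∑[ j ≤ β ] (N ^ suc t * binomialTerm (toℕ j))
      ≡⟨ sym (*-distribˡ-sum {suc β} (N ^ suc t) (λ j → binomialTerm (toℕ j))) ⟩
    N ^ suc t * ∑[ j ≤ β ] binomialTerm (toℕ j)
      ≡⟨ cong (N ^ suc t *_) (sym (binomial-theorem β (M * r) (M * r * t))) ⟩
    N ^ suc t * (M * r + M * r * t) ^ β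
      ≡⟨ cong (λ x → N ^ suc t * x ^ β) (sym (*-suc (M * r) t)) ⟩
    N ^ suc t * (M * r * suc t) ^ β
      ∎
    where
    open ≤-Reasoning
    binomialTerm : ℕ → ℕ
    binomialTerm j = binom β j * ((M * r) ^ j * (M * r * t) ^ (β ∸ j))
    ∣e∣≡r : ∀ {e} → e ∈ edges → ∣ e ∣ ≡ r
    ∣e∣≡r e∈edges = proj₂ (∈-filter⁻ (λ e → ∣ e ∣ ≟ r) {xs = allSubsets n} e∈edges)

  deficientCount-bound : ∀ t → DeficiencyBound t
  deficientCount-bound zero = deficiencyBound-zero
  deficientCount-bound (suc t) = deficiencyBound-suc (deficientCount-bound t)

[rtrt]^α≡t^α*r^[2α]*t^α : ∀ r t α → (r * t * r * t) ^ α ≡ t ^ α * r ^ (2 * α) * t ^ α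
[rtrt]^α≡t^α*r^[2α]*t^α r t α = begin
  (r * t * r * t) ^ α           ≡⟨ cong (_^ α) (regroup r t) ⟩
  (t * (r * r) * t) ^ α         ≡⟨ ^-distribʳ-* (t * (r * r)) t α ⟩
  (t * (r * r)) ^ α * t ^ α     ≡⟨ cong (_* t ^ α) (^-distribʳ-* t (r * r) α) ⟩
  t ^ α * (r * r) ^ α * t ^ α   ≡⟨ cong (λ x → t ^ α * x * t ^ α) r²-power ⟩
  t ^ α * r ^ (2 * α) * t ^ α   ∎
  where
  open ≡-Reasoning
  regroup : ∀ r t → r * t * r * t ≡ t * (r * r) * t
  regroup = solve-∀
  r²-power : (r * r) ^ α ≡ r ^ (2 * α)
  r²-power = trans (cong (λ x → (r * x) ^ α) (sym (*-identityʳ r))) (^-*-assoc r 2 α)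

module _ {n r : ℕ} (r≤n : r ≤ n) (t α : ℕ) where

  open Deficiency r≤n (r * t)

  smallUnion : List (Subset n) → ℕ
  smallUnion F = 𝟙 (∣ union F ∣ ≤? r * t ∸ α)

  totalCount≡supersets*∑ : ∀ m → totalCount n r m t α ≡ supersets N m t * ∑ (choose edges t) smallUnion
  totalCount≡supersets*∑ m = trans
    (∑-cong (Hyp n r m) (λ H → length-filter (λ F → ∣ union F ∣ ≤? r * t ∸ α) (choose H t)))
    (∑-choose-choose edges m t smallUnion)

  ∑-smallUnion-bound : α ≤ r * t →
    ∑ (choose edges t) smallUnion * (n ^ α * α !) ≤ N ^ t * (t ^ α * r ^ (2 * α) * t ^ α)
  ∑-smallUnion-bound α≤rt = begin
    ∑ (choose edges t) smallUnion * (n ^ α * α !)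
      ≤⟨ *-monoˡ-≤ (n ^ α * α !) (≤-trans (∑-choose≤∑-tuples edges t smallUnion)
                                          (∑-tuples-mono edges t smallUnion≤deficient)) ⟩
    deficientCount ⊥ t α * (n ^ α * α !)
      ≤⟨ deficientCount-bound t ⊥ α (≤-reflexive (cong (_+ r * t) (∣⊥∣≡0 n))) ⟩
    N ^ t * (r * t * r * t) ^ α
      ≡⟨ cong (N ^ t *_) ([rtrt]^α≡t^α*r^[2α]*t^α r t α) ⟩
    N ^ t * (t ^ α * r ^ (2 * α) * t ^ α)
      ∎
    where
    open ≤-Reasoning
    smallUnion≤deficient : ∀ F → smallUnion F ≤ 𝟙 (deficient? ⊥ t α F)
    smallUnion≤deficient F = 𝟙-mono (∣ union F ∣ ≤? r * t ∸ α) (deficient? ⊥ t α F) smallUnion⇒deficient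
      where
      smallUnion⇒deficient : ∣ union F ∣ ≤ r * t ∸ α → Deficient ⊥ t α F
      smallUnion⇒deficient p rewrite ∪-identityˡ (union F) | ∣⊥∣≡0 n =
        ≤-trans (+-monoˡ-≤ α p) (≤-reflexive (m∸n+n≡m α≤rt))

  supersets-Hyp-bound : ∀ {m} → m ≤ n C r → supersets N m t * N ^ t ≤ m ^ t * length (Hyp n r m)
  supersets-Hyp-bound {m} m≤C = ≤-trans (supersets-bound-diag t m≤N)
    (≤-reflexive (cong (m ^ t *_) (sym (length-choose edges m))))
    where
    m≤N : m ≤ N
    m≤N = ≤-trans m≤C (≤-reflexive (sym (trans (length-rSets n r) (binom≡C n r))))

  ∑-smallUnion*n^α-bound : ∀ {T} → t ≤ T → α ≤ r * t →
    ∑ (choose edges t) smallUnion * n ^ α ≤ T ^ T * (t ^ α * r ^ (2 * α)) * N ^ t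
  ∑-smallUnion*n^α-bound {T} t≤T α≤rt = *-cancelʳ-≤ _ _ (α !) {{α !≢0}} (begin
    B * n ^ α * α !
      ≡⟨ *-assoc B (n ^ α) (α !) ⟩
    B * (n ^ α * α !)
      ≤⟨ ∑-smallUnion-bound α≤rt ⟩
    N ^ t * (t ^ α * r ^ (2 * α) * t ^ α)
      ≤⟨ *-monoʳ-≤ (N ^ t) (*-monoʳ-≤ (t ^ α * r ^ (2 * α)) (≤-trans (^-monoˡ-≤ α t≤T) (^≤^*! T α))) ⟩
    N ^ t * (t ^ α * r ^ (2 * α) * (T ^ T * α !))
      ≡⟨ regroup (N ^ t) (t ^ α * r ^ (2 * α)) (T ^ T) (α !) ⟩
    T ^ T * (t ^ α * r ^ (2 * α)) * N ^ t * α !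
      ∎)
    where
    open ≤-Reasoning
    B = ∑ (choose edges t) smallUnion
    regroup : ∀ y a c f → y * (a * (c * f)) ≡ c * a * y * f
    regroup = solve-∀

  totalCount-bound : ∀ {m T} → t ≤ T → α ≤ r * t → m ≤ n C r →
    totalCount n r m t α * n ^ α ≤ T ^ T * (t ^ α * (r ^ (2 * α) * (m ^ t * length (Hyp n r m))))
  totalCount-bound {m} {T} t≤T α≤rt m≤C = *-cancelʳ-≤ _ _ (N ^ t) {{N^t≢0}} (begin
    totalCount n r m t α * n ^ α * N ^ t
      ≡⟨ cong (λ x → x * n ^ α * N ^ t) (totalCount≡supersets*∑ m) ⟩
    supersets N m t * B * n ^ α * N ^ t
      ≡⟨ regroup (supersets N m t) B (n ^ α) (N ^ t) ⟩
    supersets N m t * N ^ t * (B * n ^ α)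
      ≤⟨ *-mono-≤ (supersets-Hyp-bound m≤C) (∑-smallUnion*n^α-bound t≤T α≤rt) ⟩
    m ^ t * length (Hyp n r m) * (T ^ T * (t ^ α * r ^ (2 * α)) * N ^ t)
      ≡⟨ regroup′ (m ^ t * length (Hyp n r m)) (T ^ T) (t ^ α) (r ^ (2 * α)) (N ^ t) ⟩
    T ^ T * (t ^ α * (r ^ (2 * α) * (m ^ t * length (Hyp n r m)))) * N ^ t
      ∎)
    where
    open ≤-Reasoning
    B = ∑ (choose edges t) smallUnion
    N^t≢0 : NonZero (N ^ t)
    N^t≢0 = m^n≢0 N t {{>-nonZero (≤-trans (binom-pos r≤n) (≤-reflexive (sym (length-rSets n r))))}}
    regroup : ∀ k b x y → k * b * x * y ≡ k * y * (b * x)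
    regroup = solve-∀
    regroup′ : ∀ h c a b y → h * (c * (a * b) * y) ≡ c * (a * (b * h)) * y
    regroup′ = solve-∀

lemma2p2 : (r t α m : ℕ → ℕ) →
    (∀ n → 3 ≤ r n) →
    (∀ k → Σ ℕ (λ N → ∀ n → N ≤ n → suc k * (r n * r n) ≤ n)) →
    Σ ℕ (λ T → ∀ n → t n ≤ T) →
    (∀ n → α n ≤ r n * t n) →
    (∀ n → m n ≤ n C r n) →
    Σ ℕ (λ C → Σ ℕ (λ N → ∀ n → N ≤ n →
      totalCount n (r n) (m n) (t n) (α n) * n ^ α n
        ≤ C * (t n ^ α n * (r n ^ (2 * α n) * (m n ^ t n * length (Hyp n (r n) (m n)))))))
lemma2p2 r t α m 3≤r r²=o[n] (T , t≤T) α≤rt m≤C =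
  T ^ T , N₀ , λ n N₀≤n → totalCount-bound (r≤n n N₀≤n) (t n) (α n) (t≤T n) (α≤rt n) (m≤C n)
  where
  N₀ : ℕ
  N₀ = proj₁ (r²=o[n] 0)
  r≤n : ∀ n → N₀ ≤ n → r n ≤ n
  r≤n n N₀≤n = begin
    r n             ≤⟨ m≤m*n (r n) (r n) {{>-nonZero (≤-trans (s≤s z≤n) (3≤r n))}} ⟩
    r n * r n       ≡⟨ sym (*-identityˡ (r n * r n)) ⟩
    1 * (r n * r n) ≤⟨ proj₂ (r²=o[n] 0) n N₀≤n ⟩
    n               ∎
    where open ≤-Reasoning
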